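{- Let $(\mathbf o;\mathbf f_1,\mathbf f_2)$ be an integer frame splitting an integer slope $Q$ with vertices $\mathbf v_0,\dots,\mathbf v_N$, and let $k,\alpha,t,S,s$ be as defined in the context. Then $s\le t$ and $\sum_{\varepsilon_i\in S}a_{i1}\le (t-s)s+\frac{s(s+1)}{2}$. If moreover all vertices of $Q$ belong to a proper sublattice of $\mathbb{Z}^2$, then $s=t$ holds only if $s=t=0$ or $s=t=1$, and in the latter case the unique edge $\varepsilon_i\in S$ satisfies $\mathbf a_i=\mathbf f_1-\mathbf f_2$.
   Context: An integer frame is $(\mathbf o;\mathbf f_1,\mathbf f_2)$ with $\mathbf o\in\mathbb{Z}^2$ and $(\mathbf f_1,\mathbf f_2)$ a basis of $\mathbb{Z}^2$. $Q$ is an integer slope w.r.t. $(\mathbf f_1,\mathbf f_2)$: its vertices $\mathbf v_0,\dots,\mathbf v_N\in\mathbb{Z}^2$ satisfy, with $\mathbf a_i=\mathbf v_i-\mathbf v_{i-1}=a_{i1}\mathbf f_1+a_{i2}\mathbf f_2$, $a_{i1}>0,a_{i2}<0$ ($1\le i\le N$) and $a_{i1}a_{i+1,2}-a_{i+1,1}a_{i2}>0$ ($1\le i\le N-1$); its edges are $\varepsilon_i=[\mathbf v_{i-1},\mathbf v_i]$. Write $\mathbf v_i-\mathbf o=v_{i1}\mathbf f_1+v_{i2}\mathbf f_2$. The frame splits $Q$: $v_{01}<0$, $v_{02}>0$, $v_{N1}>0$, $v_{N2}<0$, and some point $\mathbf o+\lambda_1\mathbf f_1+\lambda_2\mathbf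 f_2$ of $Q$ has $\lambda_1,\lambda_2>0$. Define $k=\min\{i:v_{i2}<0\}$, $\alpha=-a_{k1}/a_{k2}$, $t=\lceil\alpha\rceil-1$, $S=\{\varepsilon_i: i<k,\ a_{i2}=-1\}$, $s=|S|$. A proper sublattice of $\mathbb{Z}^2$ is a subgroup $A\mathbb{Z}^2\ne\mathbb{Z}^2$, $A$ an integer matrix with $\det A\ne0$. -}

module Defs where

open import Data.Nat as ℕ using (ℕ; zero; suc)
open import Data.Integer as ℤ using (ℤ; +_; -_; _+_; _-_; _*_; _<_; _≤_; _≟_)
open import Data.Product using (_×_; _,_; ∃; ∃-syntax)
open import Data.Sum using (_⊎_)
open import Relation.Binary.PropositionalEquality using (_≡_; _≢_)
open import Relation.Nullary using (¬_; does)
open import Data.Bool using (if_then_else_)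

ℤ² : Set
ℤ² = ℤ × ℤ

_⊕_ : ℤ² → ℤ² → ℤ²
(a , b) ⊕ (c , d) = (a + c , b + d)

_⊖_ : ℤ² → ℤ² → ℤ²
(a , b) ⊖ (c , d) = (a - c , b - d)

_·_ : ℤ → ℤ² → ℤ²
λ' · (a , b) = (λ' * a , λ' * b)

det2 : ℤ² → ℤ² → ℤ
det2 (a , b) (c , d) = a * d - b * c

IsBasis : ℤ² → ℤ² → Set
IsBasis f₁ f₂ = det2 f₁ f₂ ≡ + 1 ⊎ det2 f₁ f₂ ≡ - (+ 1)

-- edge coordinates a_{i1}, a_{i2} from vertex coordinates v_{i1}, v_{i2}
edgeCoord : (ℕ → ℤ) → ℕ → ℤ
edgeCoord c i = c i - c (i ℕ.∸ 1)

sumS : (a₁ a₂ : ℕ → ℤ) → ℕ → ℤ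
sumS a₁ a₂ zero = + 0
sumS a₁ a₂ (suc m) =
  sumS a₁ a₂ m + (if does (a₂ (suc m) ≟ - (+ 1)) then a₁ (suc m) else + 0)

countS : (a₂ : ℕ → ℤ) → ℕ → ℕ
countS a₂ zero = 0
countS a₂ (suc m) =
  (if does (a₂ (suc m) ≟ - (+ 1)) then 1 else 0) ℕ.+ countS a₂ m

-- c = ⌈ a / b ⌉ for b > 0, i.e. c - 1 < a/b ≤ c
IsCeilDiv : ℤ → ℤ → ℤ → Set
IsCeilDiv a b c = b * (c - + 1) < a × a ≤ b * c

record Mat2 : Set where
  constructor mat
  field
    m₁₁ m₁₂ m₂₁ m₂₂ : ℤ

detM : Mat2 → ℤ
detM (mat a b c d) = a * d - b * c

_$ᴹ_ : Mat2 → ℤ² → ℤ²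
mat a b c d $ᴹ (x , y) = (a * x + b * y , c * x + d * y)

InLattice : Mat2 → ℤ² → Set
InLattice A w = ∃[ x ] A $ᴹ x ≡ w

IsProperSublattice : Mat2 → Set
IsProperSublattice A = detM A ≢ + 0 × ¬ (∀ w → InLattice A w)

-- Write a = edgeCoord v₁ and b = edgeCoord v₂. By convexity of the slope the
-- edge determinants a_i b_j − a_j b_i are positive for all i < j. Two edges with
-- b = −1 thus have strictly increasing first coordinates, and comparing such an
-- edge with ε_k gives a_i < a_k / (−b_k) ≤ t + 1. So the first coordinates of the
-- s edges of S are distinct integers in [1, t]: s ≤ t, their sum is at most the
-- sum of the s largest of them, and for s = t they are exactly 1, …, t. If t ≥ 2,
-- the edge vectors f₁ − f₂ and 2f₁ − f₂ lie in the lattice of the vertices; they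
-- form a basis of ℤ², so that lattice is not proper.
module Submission where

open import Defs
open import Data.Nat as ℕ using (ℕ; zero; suc)
open import Data.Nat.DivMod using (_/_)
open import Data.Integer as ℤ using (ℤ; +_; -_; _+_; _-_; _*_; _<_; _≤_)
open import Data.Product using (_×_; _,_; ∃; ∃-syntax; Σ-syntax)
open import Data.Sum using (_⊎_)
open import Relation.Binary.PropositionalEquality using (_≡_)
open import Relation.Nullary using (¬_)

open import Data.Empty using (⊥-elim)
import Data.Integer.Properties as ℤP
open import Data.Integer.Tactic.RingSolver using (solve-∀)
open import Data.Nat.Base using (z≤n; s≤s; s≤s⁻¹)
import Data.Nat.DivMod as ℕD
import Data.Nat.Properties as ℕP
import Data.Nat.Tactic.RingSolver as ℕR
open import Data.Product using (proj₁; proj₂)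
open import Data.Sum using (inj₁; inj₂; map₂)
open import Relation.Binary.PropositionalEquality
  using (refl; sym; trans; cong; cong₂; subst; subst₂; module ≡-Reasoning)
open import Relation.Nullary using (yes; no)

0<j-i⇒i<j : ∀ {i j} → + 0 < j - i → i < j
0<j-i⇒i<j {i} {j} 0<j-i =
  subst₂ _<_ (ℤP.+-identityʳ i) (i+[j-i]≡j i j) (ℤP.+-monoʳ-< i 0<j-i)
  where
  i+[j-i]≡j : ∀ i j → i + (j - i) ≡ j
  i+[j-i]≡j = solve-∀

0<i*j : ∀ {i j} → + 0 < i → + 0 < j → + 0 < i * j
0<i*j {i} {j} 0<i 0<j =
  subst (_< i * j) (ℤP.*-zeroʳ i) (ℤP.*-monoˡ-<-pos i {{ℤ.positive 0<i}} 0<j)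

*-cancelˡ-<-pos : ∀ {i j k} → + 0 < i → i * j < i * k → j < k
*-cancelˡ-<-pos {i} 0<i = ℤP.*-cancelˡ-<-nonNeg i {{ℤ.nonNegative (ℤP.<⇒≤ 0<i)}}

0<i*j⇒0<j : ∀ {i j} → + 0 < i → + 0 < i * j → + 0 < j
0<i*j⇒0<j {i} {j} 0<i 0<i*j = *-cancelˡ-<-pos 0<i (subst (_< i * j) (sym (ℤP.*-zeroʳ i)) 0<i*j)

i<j⇒i≤j-1 : ∀ {i j} → i < j → i ≤ j - + 1
i<j⇒i≤j-1 {j = j} i<j = subst (_ ≤_) (ℤP.+-comm (- (+ 1)) j) (ℤP.i<j⇒i≤pred[j] i<j)

i≤j-1⇒i<j : ∀ {i j} → i ≤ j - + 1 → i < j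
i≤j-1⇒i<j {j = j} i≤j-1 = ℤP.i≤pred[j]⇒i<j (subst (_ ≤_) (ℤP.+-comm j (- (+ 1))) i≤j-1)

i<j+1⇒i≤j : ∀ {i j} → i < j + + 1 → i ≤ j
i<j+1⇒i≤j {j = j} i<j+1 = subst (_ ≤_) ([j+1]-1≡j j) (i<j⇒i≤j-1 i<j+1)
  where
  [j+1]-1≡j : ∀ j → j + + 1 - + 1 ≡ j
  [j+1]-1≡j = solve-∀

triangle : ℕ → ℕ
triangle zero    = 0
triangle (suc n) = triangle n ℕ.+ suc n

triangle*2≡n*[1+n] : ∀ n → triangle n ℕ.* 2 ≡ n ℕ.* suc n
triangle*2≡n*[1+n] zero    = refl
triangle*2≡n*[1+n] (suc n) = begin
  (triangle n ℕ.+ suc n) ℕ.* 2        ≡⟨ ℕP.*-distribʳ-+ 2 (triangle n) (suc n) ⟩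
  triangle n ℕ.* 2 ℕ.+ suc n ℕ.* 2    ≡⟨ cong (ℕ._+ suc n ℕ.* 2) (triangle*2≡n*[1+n] n) ⟩
  n ℕ.* suc n ℕ.+ suc n ℕ.* 2         ≡⟨ step n ⟩
  suc n ℕ.* suc (suc n)               ∎
  where
  open ≡-Reasoning
  step : ∀ n → n ℕ.* suc n ℕ.+ suc n ℕ.* 2 ≡ suc n ℕ.* suc (suc n)
  step = ℕR.solve-∀

n*[1+n]/2≡triangle : ∀ n → n ℕ.* suc n / 2 ≡ triangle n
n*[1+n]/2≡triangle n =
  trans (cong (_/ 2) (sym (triangle*2≡n*[1+n] n))) (ℕD.m*n/n≡m (triangle n) 2)

edgeDet : (a b : ℕ → ℤ) → ℕ → ℕ → ℤ
edgeDet a b i j = a i * b j - a j * b i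

-- The step i < j ↦ i < j + 1 rests on
--   a_j · det(i, j+1) = a_i · det(j, j+1) + a_{j+1} · det(i, j).
convex-chain⇒edgeDet-pos :
  (a b : ℕ → ℤ) (N : ℕ) →
  (∀ i → 1 ℕ.≤ i → i ℕ.≤ N → + 0 < a i) →
  (∀ i → 1 ℕ.≤ i → suc i ℕ.≤ N → + 0 < edgeDet a b i (suc i)) →
  ∀ {i} j → 1 ℕ.≤ i → i ℕ.< j → j ℕ.≤ N → + 0 < edgeDet a b i j
convex-chain⇒edgeDet-pos a b N a-pos convex (suc j) 1≤i i<1+j 1+j≤N
  with ℕP.m≤n⇒m<n∨m≡n (s≤s⁻¹ i<1+j)
... | inj₂ refl = convex j 1≤i 1+j≤N
... | inj₁ i<j =
  0<i*j⇒0<j (a-pos j 1≤j j≤N)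
    (subst (+ 0 <_) (sym (expand (a _) (a j) (a (suc j)) (b _) (b j) (b (suc j))))
      (ℤP.+-mono-< (0<i*j (a-pos _ 1≤i i≤N) (convex j 1≤j 1+j≤N))
                   (0<i*j (a-pos (suc j) (s≤s z≤n) 1+j≤N)
                          (convex-chain⇒edgeDet-pos a b N a-pos convex j 1≤i i<j j≤N))))
  where
  j≤N : j ℕ.≤ N
  j≤N = ℕP.<⇒≤ 1+j≤N
  i≤N : _ ℕ.≤ N
  i≤N = ℕP.≤-trans (ℕP.<⇒≤ i<j) j≤N
  1≤j : 1 ℕ.≤ j
  1≤j = ℕP.≤-trans 1≤i (ℕP.<⇒≤ i<j)
  expand : ∀ ai aj ak bi bj bk →
    aj * (ai * bk - ak * bi) ≡ ai * (aj * bk - ak * bj) + ak * (ai * bj - aj * bi)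
  expand = solve-∀

Marked : (ℕ → ℤ) → ℕ → Set
Marked b j = b j ≡ - (+ 1)

marked-edgeDet⇒< : ∀ {a b i j} → Marked b i → Marked b j → + 0 < edgeDet a b i j → a i < a j
marked-edgeDet⇒< {a} {b} {i} {j} bi≡-1 bj≡-1 0<det =
  0<j-i⇒i<j (subst (+ 0 <_) (det≡ (a i) (a j))
    (subst₂ (λ y x → + 0 < a i * y - a j * x) bj≡-1 bi≡-1 0<det))
  where
  det≡ : ∀ x y → x * - (+ 1) - y * - (+ 1) ≡ y - x
  det≡ = solve-∀

marked-edgeDet⇒≤ : ∀ {a b i k t} → Marked b i → b k < + 0 →
  a k ≤ - b k * (t + + 1) → + 0 < edgeDet a b i k → a i ≤ t
marked-edgeDet⇒≤ {a} {b} {i} {k} {t} bi≡-1 bk<0 ak≤ 0<det =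
  i<j+1⇒i≤j (*-cancelˡ-<-pos (ℤP.neg-mono-< bk<0) (ℤP.<-≤-trans β*ai<ak ak≤))
  where
  det≡ : ∀ ai ak bk → ai * bk - ak * - (+ 1) ≡ ak - - bk * ai
  det≡ = solve-∀
  β*ai<ak : - b k * a i < a k
  β*ai<ak = 0<j-i⇒i<j (subst (+ 0 <_) (det≡ (a i) (a k) (b k))
              (subst (λ x → + 0 < a i * b k - a k * x) bi≡-1 0<det))

ceil-nonneg : ∀ {x β t} → + 0 < β → + 0 < x → x ≤ β * (t + + 1) → + 0 ≤ t
ceil-nonneg 0<β 0<x x≤ = i<j+1⇒i≤j (0<i*j⇒0<j 0<β (ℤP.<-≤-trans 0<x x≤))

lincomb : ℤ → ℤ² → ℤ → ℤ² → ℤ²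
lincomb p u q w = (p · u) ⊕ (q · w)

lincomb-1-1≡⊖ : ∀ u w → lincomb (+ 1) u (- (+ 1)) w ≡ u ⊖ w
lincomb-1-1≡⊖ (u₁ , u₂) (w₁ , w₂) = cong₂ _,_ (comp u₁ w₁) (comp u₂ w₂)
  where
  comp : ∀ x y → + 1 * x + - (+ 1) * y ≡ x - y
  comp = solve-∀

frame-⊖ : ∀ o f₁ f₂ x y x′ y′ →
  (o ⊕ lincomb x f₁ y f₂) ⊖ (o ⊕ lincomb x′ f₁ y′ f₂) ≡ lincomb (x - x′) f₁ (y - y′) f₂
frame-⊖ (o₁ , o₂) (p₁ , p₂) (q₁ , q₂) x y x′ y′ =
  cong₂ _,_ (comp o₁ p₁ q₁ x y x′ y′) (comp o₂ p₂ q₂ x y x′ y′)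
  where
  comp : ∀ o p q x y x′ y′ →
    (o + (x * p + y * q)) - (o + (x′ * p + y′ * q)) ≡ (x - x′) * p + (y - y′) * q
  comp = solve-∀

$ᴹ-lincomb : ∀ A p u q w → A $ᴹ lincomb p u q w ≡ lincomb p (A $ᴹ u) q (A $ᴹ w)
$ᴹ-lincomb (mat a b c d) p (u₁ , u₂) q (w₁ , w₂) =
  cong₂ _,_ (comp a b u₁ u₂ w₁ w₂ p q) (comp c d u₁ u₂ w₁ w₂ p q)
  where
  comp : ∀ a b u₁ u₂ w₁ w₂ p q →
    a * (p * u₁ + q * w₁) + b * (p * u₂ + q * w₂) ≡ p * (a * u₁ + b * u₂) + q * (a * w₁ + b * w₂)
  comp = solve-∀

inLattice-lincomb : ∀ A {u w} → InLattice A u → InLattice A w →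
  ∀ p q → InLattice A (lincomb p u q w)
inLattice-lincomb A (x , Ax≡u) (y , Ay≡w) p q =
  lincomb p x q y , trans ($ᴹ-lincomb A p x q y) (cong₂ (λ u w → lincomb p u q w) Ax≡u Ay≡w)

inLattice-⊖ : ∀ A {u w} → InLattice A u → InLattice A w → InLattice A (u ⊖ w)
inLattice-⊖ A {u} {w} u∈A w∈A =
  subst (InLattice A) (lincomb-1-1≡⊖ u w) (inLattice-lincomb A u∈A w∈A (+ 1) (- (+ 1)))

-- Cramer's rule; δ² = 1 makes the solution integral.
unimodular-spans : ∀ δ f₁ f₂ → δ * det2 f₁ f₂ ≡ + 1 → ∀ w → ∃[ p ] ∃[ q ] lincomb p f₁ q f₂ ≡ w
unimodular-spans δ (x₁ , y₁) (x₂ , y₂) δ*det≡1 (u₁ , u₂) =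
  δ * (u₁ * y₂ - u₂ * x₂) , δ * (x₁ * u₂ - y₁ * u₁) ,
  cong₂ _,_ (trans (first δ x₁ y₁ x₂ y₂ u₁ u₂) (scaled u₁))
            (trans (second δ x₁ y₁ x₂ y₂ u₁ u₂) (scaled u₂))
  where
  first : ∀ δ x₁ y₁ x₂ y₂ u₁ u₂ →
    δ * (u₁ * y₂ - u₂ * x₂) * x₁ + δ * (x₁ * u₂ - y₁ * u₁) * x₂ ≡ δ * (x₁ * y₂ - y₁ * x₂) * u₁
  first = solve-∀
  second : ∀ δ x₁ y₁ x₂ y₂ u₁ u₂ →
    δ * (u₁ * y₂ - u₂ * x₂) * y₁ + δ * (x₁ * u₂ - y₁ * u₁) * y₂ ≡ δ * (x₁ * y₂ - y₁ * x₂) * u₂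
  second = solve-∀
  scaled : ∀ u → δ * (x₁ * y₂ - y₁ * x₂) * u ≡ u
  scaled u = trans (cong (_* u) δ*det≡1) (ℤP.*-identityˡ u)

basis-spans : ∀ {f₁ f₂} → IsBasis f₁ f₂ → ∀ w → ∃[ p ] ∃[ q ] lincomb p f₁ q f₂ ≡ w
basis-spans {f₁} {f₂} (inj₁ det≡1)  = unimodular-spans (+ 1) f₁ f₂ (cong (+ 1 *_) det≡1)
basis-spans {f₁} {f₂} (inj₂ det≡-1) = unimodular-spans (- (+ 1)) f₁ f₂ (cong (- (+ 1) *_) det≡-1)

inLattice-basis⇒full : ∀ A f₁ f₂ → IsBasis f₁ f₂ → InLattice A f₁ → InLattice A f₂ →
  ∀ w → InLattice A w
inLattice-basis⇒full A f₁ f₂ basis f₁∈A f₂∈A w with basis-spans basis w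
... | p , q , f≡w = subst (InLattice A) f≡w (inLattice-lincomb A f₁∈A f₂∈A p q)

-- With e₁ = f₁ − f₂ and e₂ = 2f₁ − f₂ one has f₁ = e₂ − e₁ and f₂ = e₂ − 2e₁.
inLattice-[1,-1]-[2,-1]⇒full : ∀ A f₁ f₂ → IsBasis f₁ f₂ →
  InLattice A (lincomb (+ 1) f₁ (- (+ 1)) f₂) → InLattice A (lincomb (+ 2) f₁ (- (+ 1)) f₂) →
  ∀ w → InLattice A w
inLattice-[1,-1]-[2,-1]⇒full A f₁@(p₁ , p₂) f₂@(q₁ , q₂) basis e₁∈A e₂∈A =
  inLattice-basis⇒full A f₁ f₂ basis
    (subst (InLattice A) (cong₂ _,_ (f₁≡ p₁ q₁) (f₁≡ p₂ q₂)) (combine (- (+ 1))))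
    (subst (InLattice A) (cong₂ _,_ (f₂≡ p₁ q₁) (f₂≡ p₂ q₂)) (combine (- (+ 2))))
  where
  combine : ∀ m →
    InLattice A (lincomb (+ 1) (lincomb (+ 2) f₁ (- (+ 1)) f₂) m (lincomb (+ 1) f₁ (- (+ 1)) f₂))
  combine m = inLattice-lincomb A e₂∈A e₁∈A (+ 1) m
  f₁≡ : ∀ p q → + 1 * (+ 2 * p + - (+ 1) * q) + - (+ 1) * (+ 1 * p + - (+ 1) * q) ≡ p
  f₁≡ = solve-∀
  f₂≡ : ∀ p q → + 1 * (+ 2 * p + - (+ 1) * q) + - (+ 2) * (+ 1 * p + - (+ 1) * q) ≡ q
  f₂≡ = solve-∀

frame-edge : ∀ o f₁ f₂ {N} {v : ℕ → ℤ²} (v₁ v₂ : ℕ → ℤ) →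
  (∀ i → i ℕ.≤ N → v i ≡ o ⊕ lincomb (v₁ i) f₁ (v₂ i) f₂) →
  ∀ i → i ℕ.≤ N → v i ⊖ v (i ℕ.∸ 1) ≡ lincomb (edgeCoord v₁ i) f₁ (edgeCoord v₂ i) f₂
frame-edge o f₁ f₂ v₁ v₂ coords i i≤N =
  trans (cong₂ _⊖_ (coords i i≤N) (coords (i ℕ.∸ 1) (ℕP.≤-trans (ℕP.m∸n≤m i 1) i≤N)))
        (frame-⊖ o f₁ f₂ (v₁ i) (v₂ i) (v₁ (i ℕ.∸ 1)) (v₂ (i ℕ.∸ 1)))

module MarkedEdges (a b : ℕ → ℤ) (n : ℕ)
  (a-pos : ∀ j → 1 ℕ.≤ j → j ℕ.≤ n → + 0 < a j)
  (a-increasing : ∀ {i j} → 1 ℕ.≤ i → i ℕ.< j → j ℕ.≤ n → Marked b i → Marked b j → a i < a j)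
  where

  BoundedBy : ℕ → ℤ → Set
  BoundedBy m B = ∀ j → 1 ℕ.≤ j → j ℕ.≤ m → Marked b j → a j ≤ B

  Attained : ℕ → ℤ → Set
  Attained m y = ∃[ j ] (1 ℕ.≤ j × j ℕ.≤ m × Marked b j × a j ≡ y)

  private
    bounded-init : ∀ {m B} → BoundedBy (suc m) B → BoundedBy m B
    bounded-init bnd j 1≤j j≤m = bnd j 1≤j (ℕP.m≤n⇒m≤1+n j≤m)

    bounded-below-next : ∀ {m} → suc m ℕ.≤ n → Marked b (suc m) → BoundedBy m (a (suc m) - + 1)
    bounded-below-next 1+m≤n marked j 1≤j j≤m bj =
      i<j⇒i≤j-1 (a-increasing 1≤j (s≤s j≤m) 1+m≤n bj marked)

    attained-init : ∀ {m y} → Attained m y → Attained (suc m) y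
    attained-init (j , 1≤j , j≤m , bj , aj≡y) = j , 1≤j , ℕP.m≤n⇒m≤1+n j≤m , bj , aj≡y

  count-≤ : ∀ m → m ℕ.≤ n → ∀ {B} → + 0 ≤ B → BoundedBy m B → + countS b m ≤ B
  count-<-next : ∀ {m} → suc m ℕ.≤ n → Marked b (suc m) → + countS b m < a (suc m)

  count-≤ zero    _     0≤B _   = 0≤B
  count-≤ (suc m) 1+m≤n 0≤B bnd with b (suc m) ℤ.≟ - (+ 1)
  ... | no _       = count-≤ m (ℕP.<⇒≤ 1+m≤n) 0≤B (bounded-init bnd)
  ... | yes marked =
    ℤP.≤-trans (ℤP.i<j⇒suc[i]≤j (count-<-next 1+m≤n marked))
               (bnd (suc m) (s≤s z≤n) ℕP.≤-refl marked)

  count-<-next {m} 1+m≤n marked =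
    i≤j-1⇒i<j (count-≤ m (ℕP.<⇒≤ 1+m≤n) (i<j⇒i≤j-1 (a-pos (suc m) (s≤s z≤n) 1+m≤n))
                        (bounded-below-next 1+m≤n marked))

  -- The marked values are distinct integers in [1, B], so their sum is at most
  -- (B − c) + … + (B − 1) + B = (B − c) c + c (c + 1) / 2.
  sum-≤ : ∀ m → m ℕ.≤ n → ∀ {B} → BoundedBy m B →
    sumS a b m ≤ (B - + countS b m) * + countS b m + + triangle (countS b m)
  sum-≤ zero _ {B} _ = ℤP.≤-reflexive (sym (vanish B))
    where
    vanish : ∀ B → (B - + 0) * + 0 + + 0 ≡ + 0
    vanish = solve-∀
  sum-≤ (suc m) 1+m≤n {B} bnd with b (suc m) ℤ.≟ - (+ 1)
  ... | no _ = subst (_≤ _) (sym (ℤP.+-identityʳ _))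
                 (sum-≤ m (ℕP.<⇒≤ 1+m≤n) (bounded-init bnd))
  ... | yes marked = begin
    S + x                                          ≤⟨ ℤP.+-monoˡ-≤ x IH ⟩
    (x - + 1 - C) * C + T + x                      ≤⟨ ℤP.i≤i+j _ ((B - x) * (+ 1 + C))
                                                        {{ℤ.nonNegative 0≤slack}} ⟩
    (x - + 1 - C) * C + T + x + (B - x) * (+ 1 + C) ≡⟨ regroup x B C T ⟩
    (B - (+ 1 + C)) * (+ 1 + C) + (T + (+ 1 + C))  ∎
    where
    open ℤP.≤-Reasoning
    x S C T : ℤ
    x = a (suc m)
    S = sumS a b m
    C = + countS b m
    T = + triangle (countS b m)
    IH : S ≤ (x - + 1 - C) * C + T
    IH = sum-≤ m (ℕP.<⇒≤ 1+m≤n) (bounded-below-next 1+m≤n marked)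
    0≤slack : + 0 ≤ (B - x) * (+ 1 + C)
    0≤slack = ℤP.*-monoʳ-≤-nonNeg (+ 1 + C) (ℤP.i≤j⇒0≤j-i (bnd (suc m) (s≤s z≤n) ℕP.≤-refl marked))
    regroup : ∀ x B C T →
      (x - + 1 - C) * C + T + x + (B - x) * (+ 1 + C) ≡
      (B - (+ 1 + C)) * (+ 1 + C) + (T + (+ 1 + C))
    regroup = solve-∀

  count≡bound⇒attained : ∀ m → m ℕ.≤ n → ∀ {B} → BoundedBy m B → + countS b m ≡ B →
    ∀ {y} → + 1 ≤ y → y ≤ B → Attained m y
  count≡bound⇒attained zero _ _ 0≡B 1≤y y≤B =
    ⊥-elim (ℤP.<⇒≱ (ℤ.+<+ (s≤s z≤n)) (ℤP.≤-trans 1≤y (subst (_ ≤_) (sym 0≡B) y≤B)))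
  count≡bound⇒attained (suc m) 1+m≤n {B} bnd c≡B {y} 1≤y y≤B with b (suc m) ℤ.≟ - (+ 1)
  ... | no _ = attained-init (count≡bound⇒attained m (ℕP.<⇒≤ 1+m≤n) (bounded-init bnd) c≡B 1≤y y≤B)
  ... | yes marked with y ℤ.≟ a (suc m)
  ...   | yes y≡x = suc m , s≤s z≤n , ℕP.≤-refl , marked , sym y≡x
  ...   | no y≢x = attained-init
          (count≡bound⇒attained m (ℕP.<⇒≤ 1+m≤n) (bounded-below-next 1+m≤n marked) c≡x-1 1≤y
            (i<j⇒i≤j-1 (ℤP.≤∧≢⇒< (subst (y ≤_) (sym x≡B) y≤B) y≢x)))
    where
    x≡B : a (suc m) ≡ B
    x≡B = ℤP.≤-antisym (bnd (suc m) (s≤s z≤n) ℕP.≤-refl marked)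
                       (subst (_≤ a (suc m)) c≡B (ℤP.i<j⇒suc[i]≤j (count-<-next 1+m≤n marked)))
    c≡x-1 : + countS b m ≡ a (suc m) - + 1
    c≡x-1 = trans (sym ([1+c]-1≡c (+ countS b m))) (cong (_- + 1) (trans c≡B (sym x≡B)))
      where
      [1+c]-1≡c : ∀ c → + 1 + c - + 1 ≡ c
      [1+c]-1≡c = solve-∀

  -- When c = B the marked values are exactly 1, …, B, so for B ≥ 2 the edges
  -- f₁ − f₂ and 2f₁ − f₂ both occur.
  count≡bound-cases : ∀ A f₁ f₂ {B} (e : ℕ → ℤ²) → IsBasis f₁ f₂ → ¬ (∀ w → InLattice A w) →
    (∀ j → 1 ℕ.≤ j → j ℕ.≤ n → e j ≡ lincomb (a j) f₁ (b j) f₂) →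
    (∀ j → 1 ℕ.≤ j → j ℕ.≤ n → InLattice A (e j)) →
    BoundedBy n B → + countS b n ≡ B →
    (countS b n ≡ 0 × B ≡ + 0) ⊎
    (countS b n ≡ 1 × B ≡ + 1 × (∀ j → 1 ℕ.≤ j → j ℕ.≤ n → Marked b j → e j ≡ f₁ ⊖ f₂))
  count≡bound-cases A f₁ f₂ {B} e basis ¬full e≡ e∈A bnd c≡B =
    cases (countS b n) c≡B (count≡bound⇒attained n ℕP.≤-refl bnd c≡B)
    where
    marked-edge : ∀ {j y} → 1 ℕ.≤ j → j ℕ.≤ n → Marked b j → a j ≡ y →
      e j ≡ lincomb y f₁ (- (+ 1)) f₂
    marked-edge {j} 1≤j j≤n bj aj≡y =
      trans (e≡ j 1≤j j≤n) (cong₂ (λ p q → lincomb p f₁ q f₂) aj≡y bj)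

    edge-in-A : ∀ {y} → Attained n y → InLattice A (lincomb y f₁ (- (+ 1)) f₂)
    edge-in-A (j , 1≤j , j≤n , bj , aj≡y) =
      subst (InLattice A) (marked-edge 1≤j j≤n bj aj≡y) (e∈A j 1≤j j≤n)

    cases : ∀ c → + c ≡ B → (∀ {y} → + 1 ≤ y → y ≤ B → Attained n y) →
      (c ≡ 0 × B ≡ + 0) ⊎ (c ≡ 1 × B ≡ + 1 × (∀ j → 1 ℕ.≤ j → j ℕ.≤ n → Marked b j → e j ≡ f₁ ⊖ f₂))
    cases zero          0≡B _        = inj₁ (refl , sym 0≡B)
    cases (suc zero)    1≡B _        = inj₂ (refl , sym 1≡B , unit-edge)
      where
      unit-edge : ∀ j → 1 ℕ.≤ j → j ℕ.≤ n → Marked b j → e j ≡ f₁ ⊖ f₂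
      unit-edge j 1≤j j≤n bj = trans (marked-edge 1≤j j≤n bj aj≡1) (lincomb-1-1≡⊖ f₁ f₂)
        where
        aj≡1 : a j ≡ + 1
        aj≡1 = ℤP.≤-antisym (subst (a j ≤_) (sym 1≡B) (bnd j 1≤j j≤n bj))
                            (ℤP.i<j⇒suc[i]≤j (a-pos j 1≤j j≤n))
    cases (suc (suc c)) 2+c≡B attained = ⊥-elim (¬full (inLattice-[1,-1]-[2,-1]⇒full A f₁ f₂ basis
      (edge-in-A (attained ℤP.≤-refl (subst (+ 1 ≤_) 2+c≡B (ℤ.+≤+ (s≤s z≤n)))))
      (edge-in-A (attained (ℤ.+≤+ (s≤s z≤n)) (subst (+ 2 ≤_) 2+c≡B (ℤ.+≤+ (s≤s (s≤s z≤n))))))))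

lemma6p3 : (o f₁ f₂ : ℤ²) → IsBasis f₁ f₂ →
    (N : ℕ) (v : ℕ → ℤ²) (v₁ v₂ : ℕ → ℤ) →
    (∀ i → i ℕ.≤ N → v i ≡ o ⊕ ((v₁ i · f₁) ⊕ (v₂ i · f₂))) →
    (∀ i → 1 ℕ.≤ i → i ℕ.≤ N → + 0 < edgeCoord v₁ i × edgeCoord v₂ i < + 0) →
    (∀ i → 1 ℕ.≤ i → suc i ℕ.≤ N →
      + 0 < edgeCoord v₁ i * edgeCoord v₂ (suc i) - edgeCoord v₁ (suc i) * edgeCoord v₂ i) →
    v₁ 0 < + 0 → + 0 < v₂ 0 → + 0 < v₁ N → v₂ N < + 0 →
    (∃[ i ] (1 ℕ.≤ i × i ℕ.≤ N × (∃[ p ] ∃[ q ]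
      (+ 0 ≤ p × p ≤ q × + 0 < q ×
       + 0 < q * v₁ (i ℕ.∸ 1) + p * edgeCoord v₁ i ×
       + 0 < q * v₂ (i ℕ.∸ 1) + p * edgeCoord v₂ i)))) →
    (k : ℕ) → k ℕ.≤ N → v₂ k < + 0 → (∀ i → i ℕ.< k → ¬ (v₂ i < + 0)) →
    (t : ℤ) → IsCeilDiv (edgeCoord v₁ k) (- edgeCoord v₂ k) (t + + 1) →
    let s = countS (edgeCoord v₂) (k ℕ.∸ 1) in
    (+ s ≤ t) ×
    (sumS (edgeCoord v₁) (edgeCoord v₂) (k ℕ.∸ 1) ≤ (t - + s) * + s + + ((s ℕ.* suc s) / 2)) ×
    ((Σ[ A ∈ Mat2 ] (IsProperSublattice A × (∀ i → i ℕ.≤ N → InLattice A (v i)))) →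
      + s ≡ t →
      ((s ≡ 0 × t ≡ + 0) ⊎
       (s ≡ 1 × t ≡ + 1 ×
        (∀ i → 1 ℕ.≤ i → i ℕ.< k → edgeCoord v₂ i ≡ - (+ 1) → v i ⊖ v (i ℕ.∸ 1) ≡ f₁ ⊖ f₂))))
lemma6p3 _ _ _ _ _ _ _ _ _ _ _ _ 0<v₂0 _ _ _ zero _ v₂0<0 _ _ _ = ⊥-elim (ℤP.<-asym v₂0<0 0<v₂0)
lemma6p3 o f₁ f₂ basis N v v₁ v₂ coords edge convex _ _ _ _ _ (suc k) 1+k≤N _ _ t (_ , ak≤) =
  count-≤ k ℕP.≤-refl 0≤t bounded ,
  subst (λ m → sumS a b k ≤ (t - + s) * + s + + m) (sym (n*[1+n]/2≡triangle s))
    (sum-≤ k ℕP.≤-refl bounded) ,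
  λ { (A , (_ , ¬full) , v∈A) s≡t →
      map₂ (λ { (s≡1 , t≡1 , unit) → s≡1 , t≡1 , λ i 1≤i i<1+k → unit i 1≤i (s≤s⁻¹ i<1+k) })
        (count≡bound-cases A f₁ f₂ (λ j → v j ⊖ v (j ℕ.∸ 1)) basis ¬full
          (λ j _ j≤k → frame-edge o f₁ f₂ v₁ v₂ coords j (≤N j≤k))
          (λ j _ j≤k → inLattice-⊖ A (v∈A j (≤N j≤k))
                                     (v∈A (j ℕ.∸ 1) (≤N (ℕP.≤-trans (ℕP.m∸n≤m j 1) j≤k))))
          bounded s≡t) }
  where
  a b : ℕ → ℤ
  a = edgeCoord v₁
  b = edgeCoord v₂
  s : ℕ
  s = countS b k
  ≤N : ∀ {j} → j ℕ.≤ k → j ℕ.≤ N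
  ≤N j≤k = ℕP.≤-trans j≤k (ℕP.<⇒≤ 1+k≤N)
  edgeDet-pos : ∀ {i} j → 1 ℕ.≤ i → i ℕ.< j → j ℕ.≤ N → + 0 < edgeDet a b i j
  edgeDet-pos = convex-chain⇒edgeDet-pos a b N (λ j 1≤j j≤N → proj₁ (edge j 1≤j j≤N)) convex
  open MarkedEdges a b k (λ j 1≤j j≤k → proj₁ (edge j 1≤j (≤N j≤k)))
    (λ 1≤i i<j j≤k bi bj → marked-edgeDet⇒< {a} {b} bi bj (edgeDet-pos _ 1≤i i<j (≤N j≤k)))
  last-edge : + 0 < a (suc k) × b (suc k) < + 0
  last-edge = edge (suc k) (s≤s z≤n) 1+k≤N
  bounded : BoundedBy k t
  bounded j 1≤j j≤k bj =
    marked-edgeDet⇒≤ {a} {b} bj (proj₂ last-edge) ak≤ (edgeDet-pos (suc k) 1≤j (s≤s j≤k) 1+k≤N)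
  0≤t : + 0 ≤ t
  0≤t = ceil-nonneg (ℤP.neg-mono-< (proj₂ last-edge)) (proj₁ last-edge) ak≤
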